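{- For every positive integer $c$ there exist constants $\alpha>0$ and $k_0$ (depending on $c$) such that for every integer $k>k_0$ and every balanced partition of the vertices $v_0,\dots,v_{3^k-1}$ of $G_k$ into two sides in which each side forms at most $c$ blocks, there exist two blocks $R$ and $B$ on opposite sides of the partition with $$\min(|R|,|B|)\ \ge\ \alpha\, 3^{k/c^2}\,(1+\ell),$$ where $\ell$ is the number of vertices lying strictly between $R$ and $B$ in the order $v_0,\dots,v_{3^k-1}$.
   Context: $G_k$ is a graph with $n=3^k$ vertices $v_0,\dots,v_{3^k-1}$ linearly ordered (the order along the boundary of a specific confluent drawing); only this ordering is used in the statement. A balanced partition is a partition of the vertex set into two subsets each with at least $n/3$ vertices. A block of the partition is a maximal set of vertices consecutive in the order $v_0,\dots,v_{3^k-1}$ that all lie on the same side. (The paper states the conclusion as: the smaller of the two block lengths is $\Omega_c(3^{k/c^2})$ times larger than $1+\ell$, where $\Omega_c$ means the asymptotic bound in $k$ holds for each fixed $c$, with constants depending on $c$.) -}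

module Defs where

open import Data.Nat using (ℕ; zero; suc; _+_; _*_; _∸_; _^_; _≤_; _<_; _<ᵇ_)
open import Data.Nat as ℕ using (_⊓_)
open import Data.Fin using (Fin; zero; suc; toℕ; inject₁)
open import Data.Bool using (Bool; true; false; if_then_else_; _∧_; not)
open import Data.Bool.Properties using () renaming (_≟_ to _≟B_)
open import Data.List using (List; map)
open import Data.Nat.ListAction using (sum)
open import Data.List using () renaming (allFin to allFinL)
open import Relation.Nullary using (¬_)
open import Relation.Nullary.Decidable using (⌊_⌋)
open import Relation.Binary.PropositionalEquality using (_≡_; _≢_)

-- A two-sided partition of the vertices v_0,…,v_{n-1} (identified with Fin n,
-- in the given linear order): each vertex is sent to its side (true / false).
Colouring : ℕ → Set
Colouring n = Fin n → Bool

sideSize : ∀ {n} → Colouring n → Bool → ℕ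
sideSize {n} f s = sum (map (λ i → if ⌊ f i ≟B s ⌋ then 1 else 0) (allFinL n))

Balanced : ∀ {n} → Colouring n → Set
Balanced {n} f = ∀ (s : Bool) → n ≤ 3 * sideSize f s

record Block {n : ℕ} (f : Colouring n) : Set where
  field
    start end  : Fin n
    ordered    : toℕ start ≤ toℕ end
    constant   : ∀ (m : Fin n) → toℕ start ≤ toℕ m → toℕ m ≤ toℕ end → f m ≡ f start
    maxLeft    : ∀ (m : Fin n) → suc (toℕ m) ≡ toℕ start → f m ≢ f start
    maxRight   : ∀ (m : Fin n) → toℕ m ≡ suc (toℕ end) → f m ≢ f start

  side : Bool
  side = f start

  size : ℕ
  size = suc (toℕ end ∸ toℕ start)

open Block public

startsBlock : ∀ {n} → Colouring n → Fin n → Bool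
startsBlock {suc n} f zero = true
startsBlock {suc n} f (suc i) = not ⌊ f (inject₁ i) ≟B f (suc i) ⌋

blockCount : ∀ {n} → Colouring n → Bool → ℕ
blockCount {n} f s =
  sum (map (λ i → if ⌊ f i ≟B s ⌋ ∧ startsBlock f i then 1 else 0) (allFinL n))

between : ∀ {n} {f : Colouring n} → Block f → Block f → ℕ
between R B =
  if toℕ (end R) <ᵇ toℕ (start B)
  then toℕ (start B) ∸ suc (toℕ (end R))
  else toℕ (start R) ∸ suc (toℕ (end B))

-- Each side has at least n/3 vertices in at most c blocks, so it has a block of length at
-- least n/3c; take such blocks R and B on opposite sides, R before B.  With q = 3c + 1 and
-- E = c², keep the invariant  n^(1+r) ≤ (q·min(|R|,|B|))^E,  where r is the number of blocks
-- strictly between R and B; initially r ≤ 2c − 2, so 1 + r ≤ E.  If the pair fails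
-- n(1+ℓ)^E ≤ (q·min)^E, the ℓ vertices between R and B lie in r blocks, one of which, X,
-- has (1+r)|X| ≥ 1 + ℓ.  Replacing R or B by X (whichever keeps the sides opposite) removes a
-- block from the gap, and the failed inequality gives (q·min)^E < n(q|X|)^E, so the invariant
-- survives with one factor n less.  The gap shrinks each time, so the process stops at a
-- pair satisfying the inequality.

module Submission where

open import Defs
open import Data.Nat using (ℕ; zero; suc; _+_; _*_; _∸_; _^_; _≤_; _<_; _⊓_; _⊔_; z≤n; s≤s; _<?_; _≤?_; _<ᵇ_; _≡ᵇ_; NonZero; >-nonZero⁻¹)
open import Data.Nat.Properties
open import Data.Nat.ListAction using (sum)
open import Data.Nat.Solver using (module +-*-Solver)
open import Data.Fin using (Fin; toℕ; fromℕ<; inject₁) renaming (zero to fzero; suc to fsuc)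
open import Data.Fin.Properties using (toℕ<n; fromℕ<-toℕ; toℕ-fromℕ<; toℕ-inject₁)
open import Data.Bool using (Bool; true; false; if_then_else_; _∧_; not; T)
open import Data.Bool.Properties using () renaming (_≟_ to _≟ᴮ_)
open import Data.List using (map; tabulate; allFin)
open import Data.List.Properties using (map-tabulate)
open import Data.Product using (Σ; _×_; _,_; proj₁; proj₂)
open import Data.Sum using (_⊎_; inj₁; inj₂)
open import Data.Empty using (⊥-elim)
open import Relation.Nullary using (¬_; Dec; yes; no)
open import Relation.Nullary.Decidable using (⌊_⌋)
open import Relation.Binary.PropositionalEquality
open +-*-Solver using (solve; _:+_; _:*_; _:=_; con)

𝟙 : Bool → ℕ
𝟙 b = if b then 1 else 0

1≤𝟙 : ∀ {b} → b ≡ true → 1 ≤ 𝟙 b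
1≤𝟙 refl = ≤-refl

sumFrom : (ℕ → ℕ) → ℕ → ℕ → ℕ
sumFrom h a zero    = 0
sumFrom h a (suc l) = h a + sumFrom h (suc a) l

sumFrom-+ : ∀ h a l₁ l₂ → sumFrom h a (l₁ + l₂) ≡ sumFrom h a l₁ + sumFrom h (a + l₁) l₂
sumFrom-+ h a zero     l₂ rewrite +-identityʳ a = refl
sumFrom-+ h a (suc l₁) l₂ rewrite sumFrom-+ h (suc a) l₁ l₂ | +-suc a l₁ =
  sym (+-assoc (h a) _ _)

sumFrom-suc : ∀ h a l → sumFrom h a (suc l) ≡ sumFrom h a l + h (a + l)
sumFrom-suc h a l = begin
  sumFrom h a (suc l)                   ≡⟨ cong (sumFrom h a) (+-comm 1 l) ⟩
  sumFrom h a (l + 1)                   ≡⟨ sumFrom-+ h a l 1 ⟩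
  sumFrom h a l + (h (a + l) + 0)       ≡⟨ cong (sumFrom h a l +_) (+-identityʳ _) ⟩
  sumFrom h a l + h (a + l)             ∎
  where open ≡-Reasoning

sumFrom-cong : ∀ {h h′} → (∀ i → h i ≡ h′ i) → ∀ a l → sumFrom h a l ≡ sumFrom h′ a l
sumFrom-cong eq a zero    = refl
sumFrom-cong eq a (suc l) = cong₂ _+_ (eq a) (sumFrom-cong eq (suc a) l)

sumFrom-distrib-+ : ∀ h₁ h₂ a l →
  sumFrom (λ i → h₁ i + h₂ i) a l ≡ sumFrom h₁ a l + sumFrom h₂ a l
sumFrom-distrib-+ h₁ h₂ a zero    = refl
sumFrom-distrib-+ h₁ h₂ a (suc l) rewrite sumFrom-distrib-+ h₁ h₂ (suc a) l =
  solve 4 (λ x y u v → (x :+ y) :+ (u :+ v) := (x :+ u) :+ (y :+ v)) refl (h₁ a) (h₂ a) _ _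

sumFrom-1 : ∀ a l → sumFrom (λ _ → 1) a l ≡ l
sumFrom-1 a zero    = refl
sumFrom-1 a (suc l) = cong suc (sumFrom-1 (suc a) l)

sumRange : (ℕ → ℕ) → ℕ → ℕ → ℕ
sumRange h a b = sumFrom h a (b ∸ a)

sumRange-split : ∀ h {a m b} → a ≤ m → m ≤ b → sumRange h a b ≡ sumRange h a m + sumRange h m b
sumRange-split h {a} {m} {b} a≤m m≤b = begin
  sumFrom h a (b ∸ a)                        ≡⟨ cong (sumFrom h a) b∸a ⟩
  sumFrom h a ((m ∸ a) + (b ∸ m))            ≡⟨ sumFrom-+ h a (m ∸ a) (b ∸ m) ⟩
  sumFrom h a (m ∸ a) + sumFrom h (a + (m ∸ a)) (b ∸ m)
    ≡⟨ cong (λ x → sumFrom h a (m ∸ a) + sumFrom h x (b ∸ m)) (m+[n∸m]≡n a≤m) ⟩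
  sumFrom h a (m ∸ a) + sumFrom h m (b ∸ m)  ∎
  where
  open ≡-Reasoning
  b∸a : b ∸ a ≡ (m ∸ a) + (b ∸ m)
  b∸a = begin
    b ∸ a             ≡⟨ cong (_∸ a) (sym (m∸n+n≡m m≤b)) ⟩
    (b ∸ m) + m ∸ a   ≡⟨ +-∸-assoc (b ∸ m) a≤m ⟩
    (b ∸ m) + (m ∸ a) ≡⟨ +-comm (b ∸ m) (m ∸ a) ⟩
    (m ∸ a) + (b ∸ m) ∎

head≤sumRange : ∀ h {a b} → a < b → h a ≤ sumRange h a b
head≤sumRange h {a} {b} a<b with b ∸ a | m<n⇒0<n∸m a<b
... | suc l | _ = m≤m+n (h a) _

sumRange-<-dropLast : ∀ h {a m b} → 1 ≤ h m → a ≤ m → m < b → sumRange h a m < sumRange h a b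
sumRange-<-dropLast h {a} {m} {b} positive a≤m m<b = begin-strict
  sumRange h a m                        <⟨ m<m+n (sumRange h a m) positive ⟩
  sumRange h a m + h m                  ≤⟨ +-monoʳ-≤ (sumRange h a m) (head≤sumRange h m<b) ⟩
  sumRange h a m + sumRange h m b       ≡⟨ sym (sumRange-split h a≤m (<⇒≤ m<b)) ⟩
  sumRange h a b                        ∎
  where open ≤-Reasoning

sumRange-<-dropFirst : ∀ h {a m b} → 1 ≤ h a → a < m → m ≤ b → sumRange h m b < sumRange h a b
sumRange-<-dropFirst h {a} {m} {b} positive a<m m≤b = begin-strict
  sumRange h m b                        <⟨ m<n+m (sumRange h m b) positive ⟩
  h a + sumRange h m b                  ≤⟨ +-monoˡ-≤ (sumRange h m b) (head≤sumRange h a<m) ⟩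
  sumRange h a m + sumRange h m b       ≡⟨ sym (sumRange-split h (<⇒≤ a<m) m≤b) ⟩
  sumRange h a b                        ∎
  where open ≤-Reasoning

≤-*-pigeonhole : ∀ {N₁ N₂} P₁ P₂ {L₁ L₂} → N₁ ≤ P₁ * L₁ → N₂ ≤ P₂ * L₂ → L₂ ≤ L₁ →
                 N₁ + N₂ ≤ (P₁ + P₂) * L₁
≤-*-pigeonhole P₁ P₂ {L₁} bound₁ bound₂ L₂≤L₁ =
  ≤-trans (+-mono-≤ bound₁ (≤-trans bound₂ (*-monoʳ-≤ P₂ L₂≤L₁)))
          (≤-reflexive (sym (*-distribʳ-+ L₁ P₁ P₂)))

-- One run fewer in the gap pays for the factor n lost when the minimum length drops from m to L.
potential-transfer : ∀ n .{{_ : NonZero n}} q E {r r′ m m′ L ℓ} → r′ < r →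
  n ^ (1 + r) ≤ (q * m) ^ E → (q * m) ^ E < n * (1 + ℓ) ^ E → 1 + ℓ ≤ q * L → m ⊓ L ≤ m′ →
  n ^ (1 + r′) ≤ (q * m′) ^ E
potential-transfer n q E {r} {r′} {m} {m′} {L} {ℓ} r′<r potential short long m⊓L≤m′ =
  *-cancelˡ-≤ n (begin
    n * n ^ (1 + r′)         ≤⟨ ^-monoʳ-≤ n {2 + r′} {1 + r} (s≤s r′<r) ⟩
    n ^ (1 + r)              ≤⟨ potential ⟩
    (q * m) ^ E              ≤⟨ bound-by-min ⟩
    n * (q * (m ⊓ L)) ^ E    ≤⟨ *-monoʳ-≤ n (^-monoˡ-≤ E (*-monoʳ-≤ q m⊓L≤m′)) ⟩
    n * (q * m′) ^ E         ∎)
  where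
  open ≤-Reasoning
  bound-by-min : (q * m) ^ E ≤ n * (q * (m ⊓ L)) ^ E
  bound-by-min with ⊓-sel m L
  ... | inj₁ eq rewrite eq = m≤n*m ((q * m) ^ E) n
  ... | inj₂ eq rewrite eq = ≤-trans (<⇒≤ short) (*-monoʳ-≤ n (^-monoˡ-≤ E long))

n*1^E≤n^[1+r] : ∀ n .{{_ : NonZero n}} E r → n * 1 ^ E ≤ n ^ (1 + r)
n*1^E≤n^[1+r] n E r rewrite ^-zeroˡ E = ^-monoʳ-≤ n {1} {1 + r} (s≤s z≤n)

2+r≤c+c⇒1+r≤c*c : ∀ c r → 2 + r ≤ c + c → 1 + r ≤ c * c
2+r≤c+c⇒1+r≤c*c (suc d) r bound =
  ≤-trans (≤-pred (subst (2 + r ≤_) (+-suc (suc d) d) bound))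
          (s≤s (+-monoʳ-≤ d (m≤m*n d (suc d))))

2+r≤c+c⇒r<3c+1 : ∀ c r → 2 + r ≤ c + c → r < 3 * c + 1
2+r≤c+c⇒r<3c+1 c r bound =
  ≤-trans (s≤s (≤-trans (m≤n+m r 2) (≤-trans bound (+-monoʳ-≤ c (m≤m+n c (c + 0))))))
          (≤-reflexive (+-comm 1 (3 * c)))

module Runs (g : ℕ → Bool) where

  startsRun : ℕ → Bool
  startsRun zero    = true
  startsRun (suc j) = not ⌊ g j ≟ᴮ g (suc j) ⌋

  startsRun-suc⇒≢ : ∀ j → startsRun (suc j) ≡ true → g j ≢ g (suc j)
  startsRun-suc⇒≢ j starts eq with g j ≟ᴮ g (suc j)
  startsRun-suc⇒≢ j () eq | yes _
  ... | no neq = neq eq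

  ≢⇒startsRun-suc : ∀ j → g j ≢ g (suc j) → startsRun (suc j) ≡ true
  ≢⇒startsRun-suc j neq with g j ≟ᴮ g (suc j)
  ... | yes eq = ⊥-elim (neq eq)
  ... | no _   = refl

  Coloured : Bool → ℕ → ℕ → Set
  Coloured s y z = ∀ i → y ≤ i → i < z → g i ≡ s

  colourCount : Bool → ℕ → ℕ → ℕ
  colourCount s = sumFrom (λ j → 𝟙 ⌊ g j ≟ᴮ s ⌋)

  runCount : Bool → ℕ → ℕ → ℕ
  runCount s = sumFrom (λ j → 𝟙 (⌊ g j ≟ᴮ s ⌋ ∧ startsRun j))

  startMark : ℕ → ℕ
  startMark j = 𝟙 (startsRun j)

  startCount : ℕ → ℕ → ℕ
  startCount = sumFrom startMark

  colourCount-partition : ∀ a l → colourCount true a l + colourCount false a l ≡ l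
  colourCount-partition a l = begin
    colourCount true a l + colourCount false a l
      ≡⟨ sym (sumFrom-distrib-+ _ _ a l) ⟩
    sumFrom (λ j → 𝟙 ⌊ g j ≟ᴮ true ⌋ + 𝟙 ⌊ g j ≟ᴮ false ⌋) a l
      ≡⟨ sumFrom-cong (λ j → 𝟙-partition (g j)) a l ⟩
    sumFrom (λ _ → 1) a l
      ≡⟨ sumFrom-1 a l ⟩
    l ∎
    where
    open ≡-Reasoning
    𝟙-partition : ∀ b → 𝟙 ⌊ b ≟ᴮ true ⌋ + 𝟙 ⌊ b ≟ᴮ false ⌋ ≡ 1
    𝟙-partition true  = refl
    𝟙-partition false = refl

  runCount-partition : ∀ a l → runCount true a l + runCount false a l ≡ startCount a l
  runCount-partition a l = trans (sym (sumFrom-distrib-+ _ _ a l))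
                                 (sumFrom-cong (λ j → 𝟙-partition (g j) (startsRun j)) a l)
    where
    𝟙-partition : ∀ b x → 𝟙 (⌊ b ≟ᴮ true ⌋ ∧ x) + 𝟙 (⌊ b ≟ᴮ false ⌋ ∧ x) ≡ 𝟙 x
    𝟙-partition true  true  = refl
    𝟙-partition true  false = refl
    𝟙-partition false true  = refl
    𝟙-partition false false = refl

module LongestRun (g : ℕ → Bool) (a : ℕ) (a-starts : Runs.startsRun g a ≡ true) where

  open Runs g

  module OfColour (s : Bool) where

    -- length of the s-coloured run ending just before a + l, cut off at a
    runLength : ℕ → ℕ
    runLength zero    = 0
    runLength (suc l) = if ⌊ g (a + l) ≟ᴮ s ⌋ then suc (runLength l) else 0

    runLength-coloured : ∀ l → runLength l ≤ l × Coloured s (a + l ∸ runLength l) (a + l)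
    runLength-coloured zero = z≤n , λ i a≤i i<a → ⊥-elim (<⇒≱ i<a a≤i)
    runLength-coloured (suc l) with g (a + l) ≟ᴮ s
    ... | no _    = z≤n , λ i a≤i i<a → ⊥-elim (<⇒≱ i<a a≤i)
    ... | yes g≡s = s≤s (proj₁ (runLength-coloured l)) , coloured
      where
      coloured : Coloured s (a + suc l ∸ suc (runLength l)) (a + suc l)
      coloured i y≤i i<z with i ≟ a + l
      ... | yes refl = g≡s
      ... | no i≢    = proj₂ (runLength-coloured l) i
                         (subst (λ x → x ∸ suc (runLength l) ≤ i) (+-suc a l) y≤i)
                         (≤∧≢⇒< (≤-pred (subst (i <_) (+-suc a l) i<z)) i≢)

    startsRun-runLength : ∀ l → g (a + l) ≡ s → startsRun (a + l) ≡ (runLength l ≡ᵇ 0)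
    startsRun-runLength zero    _   rewrite +-identityʳ a = a-starts
    startsRun-runLength (suc l) g≡s rewrite +-suc a l | g≡s with g (a + l) ≟ᴮ s
    ... | yes _ = refl
    ... | no _  = refl

    module _ (M : ℕ) where

      -- each completed run contributes at most M vertices, the current one its length c
      CountBound : ℕ → ℕ → ℕ → Set
      CountBound zero    N P = N ≤ P * M
      CountBound (suc c) N P = N + M ≤ P * M + suc c

      countBound-close : ∀ c N P → c ≤ M → CountBound c N P → N ≤ P * M
      countBound-close zero    N P _   bound = bound
      countBound-close (suc c) N P c≤M bound =
        +-cancelʳ-≤ M N (P * M) (≤-trans bound (+-monoʳ-≤ (P * M) c≤M))

      countBound-newRun : ∀ N P → N ≤ P * M → N + 1 + M ≤ (P + 1) * M + 1
      countBound-newRun N P bound = subst₂ _≤_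
        (solve 2 (λ N M → N :+ M :+ con 1 := N :+ con 1 :+ M) refl N M)
        (solve 2 (λ M P → P :* M :+ M :+ con 1 := (P :+ con 1) :* M :+ con 1) refl M P)
        (+-monoˡ-≤ 1 (+-monoˡ-≤ M bound))

      countBound-extend : ∀ N P c → N + M ≤ P * M + suc c → N + 1 + M ≤ (P + 0) * M + suc (suc c)
      countBound-extend N P c bound = subst₂ _≤_
        (solve 2 (λ N M → N :+ M :+ con 1 := N :+ con 1 :+ M) refl N M)
        (solve 3 (λ M P c → P :* M :+ (con 1 :+ c) :+ con 1
                          := (P :+ con 0) :* M :+ (con 1 :+ (con 1 :+ c))) refl M P c)
        (+-monoˡ-≤ 1 bound)

      countBound : ∀ l → (∀ j → j ≤ l → runLength j ≤ M) →
                   CountBound (runLength l) (colourCount s a l) (runCount s a l)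
      countBound zero    _       = z≤n
      countBound (suc l) bounded
        rewrite sumFrom-suc (λ j → 𝟙 ⌊ g j ≟ᴮ s ⌋) a l
              | sumFrom-suc (λ j → 𝟙 (⌊ g j ≟ᴮ s ⌋ ∧ startsRun j)) a l
        with g (a + l) ≟ᴮ s | countBound l (λ j j≤l → bounded j (≤-trans j≤l (n≤1+n l)))
      ... | no _ | bound rewrite +-identityʳ (colourCount s a l) | +-identityʳ (runCount s a l) =
        countBound-close (runLength l) _ _ (bounded l (n≤1+n l)) bound
      ... | yes g≡s | bound with startsRun-runLength l g≡s
      ...   | starts with runLength l
      ...     | zero  rewrite starts = countBound-newRun (colourCount s a l) (runCount s a l) bound
      ...     | suc c rewrite starts = countBound-extend (colourCount s a l) (runCount s a l) c bound

    maxRunLength : ℕ → ℕ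
    maxRunLength zero    = 0
    maxRunLength (suc l) = maxRunLength l ⊔ runLength (suc l)

    runLength≤max : ∀ l j → j ≤ l → runLength j ≤ maxRunLength l
    runLength≤max zero    zero    _   = z≤n
    runLength≤max (suc l) j       j≤l with j ≟ suc l
    ... | yes refl = m≤n⊔m (maxRunLength l) (runLength (suc l))
    ... | no j≢    = ≤-trans (runLength≤max l j (≤-pred (≤∧≢⇒< j≤l j≢)))
                             (m≤m⊔n (maxRunLength l) (runLength (suc l)))

    maxRunLength-attained : ∀ l → Σ ℕ λ j → j ≤ l × runLength j ≡ maxRunLength l
    maxRunLength-attained zero = 0 , z≤n , refl
    maxRunLength-attained (suc l) with ⊔-sel (maxRunLength l) (runLength (suc l))
    ... | inj₁ eq = let j , j≤l , attained = maxRunLength-attained l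
                    in j , ≤-trans j≤l (n≤1+n l) , trans attained (sym eq)
    ... | inj₂ eq = suc l , ≤-refl , sym eq

    longestRun : ∀ l → Σ ℕ λ y → Σ ℕ λ z →
      a ≤ y × z ≤ a + l × Coloured s y z × colourCount s a l ≤ runCount s a l * (z ∸ y)
    longestRun l with maxRunLength-attained l
    ... | j , j≤l , attained =
      a + j ∸ runLength j , a + j , a≤y , +-monoʳ-≤ a j≤l , proj₂ (runLength-coloured j) ,
      subst (λ L → colourCount s a l ≤ runCount s a l * L) length≡
        (countBound-close (maxRunLength l) (runLength l) _ _ (runLength≤max l l ≤-refl)
                          (countBound (maxRunLength l) l (runLength≤max l)))
      where
      L≤a+j : runLength j ≤ a + j
      L≤a+j = ≤-trans (proj₁ (runLength-coloured j)) (m≤n+m j a)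
      a≤y : a ≤ a + j ∸ runLength j
      a≤y = subst (_≤ a + j ∸ runLength j) (m+n∸n≡m a j)
                  (∸-monoʳ-≤ (a + j) (proj₁ (runLength-coloured j)))
      length≡ : maxRunLength l ≡ a + j ∸ (a + j ∸ runLength j)
      length≡ = trans (sym attained) (sym (m∸[m∸n]≡n L≤a+j))

  longestRun-anyColour : ∀ l →
    Σ Bool λ s → Σ ℕ λ y → Σ ℕ λ z →
      a ≤ y × z ≤ a + l × Coloured s y z × l ≤ startCount a l * (z ∸ y)
  longestRun-anyColour l with OfColour.longestRun true l | OfColour.longestRun false l
  ... | yᵗ , zᵗ , a≤yᵗ , zᵗ≤ , colᵗ , boundᵗ | yᶠ , zᶠ , a≤yᶠ , zᶠ≤ , colᶠ , boundᶠ
    with ≤-total (zᶠ ∸ yᶠ) (zᵗ ∸ yᵗ)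
  ...   | inj₁ f≤t = true , yᵗ , zᵗ , a≤yᵗ , zᵗ≤ , colᵗ ,
            subst₂ (λ u v → u ≤ v * (zᵗ ∸ yᵗ)) (colourCount-partition a l) (runCount-partition a l)
                   (≤-*-pigeonhole (runCount true a l) (runCount false a l) boundᵗ boundᶠ f≤t)
  ...   | inj₂ t≤f = false , yᶠ , zᶠ , a≤yᶠ , zᶠ≤ , colᶠ ,
            subst₂ (λ u v → u ≤ v * (zᶠ ∸ yᶠ))
                   (trans (+-comm (colourCount false a l) _) (colourCount-partition a l))
                   (trans (+-comm (runCount false a l) _) (runCount-partition a l))
                   (≤-*-pigeonhole (runCount false a l) (runCount true a l) boundᶠ boundᵗ t≤f)

module MaximalRuns (n : ℕ) (g : ℕ → Bool) where

  open Runs g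

  record MaxRun : Set where
    field
      first last : ℕ
      first≤last : first ≤ last
      last<n     : last < n
      constant   : ∀ j → first ≤ j → j ≤ last → g j ≡ g first
      starts     : startsRun first ≡ true
      ends       : suc last ≡ n ⊎ g last ≢ g (suc last)

    colour : Bool
    colour = g first

    length : ℕ
    length = suc (last ∸ first)

  open MaxRun public

  first<n : ∀ X → first X < n
  first<n X = ≤-<-trans (first≤last X) (last<n X)

  runStart : ℕ → ℕ
  runStart zero    = zero
  runStart (suc i) = if ⌊ g i ≟ᴮ g (suc i) ⌋ then runStart i else suc i

  runStart≤ : ∀ i → runStart i ≤ i
  runStart≤ zero = z≤n
  runStart≤ (suc i) with g i ≟ᴮ g (suc i)
  ... | yes _ = ≤-trans (runStart≤ i) (n≤1+n i)
  ... | no _  = ≤-refl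

  runStart-constant : ∀ i j → runStart i ≤ j → j ≤ i → g j ≡ g i
  runStart-constant zero    zero    _ _ = refl
  runStart-constant (suc i) j s≤j j≤i with g i ≟ᴮ g (suc i) | j ≟ suc i
  ... | _      | yes refl = refl
  ... | yes eq | no j≢    = trans (runStart-constant i j s≤j (≤-pred (≤∧≢⇒< j≤i j≢))) eq
  ... | no _   | no j≢    = ⊥-elim (j≢ (≤-antisym j≤i s≤j))

  startsRun-runStart : ∀ i → startsRun (runStart i) ≡ true
  startsRun-runStart zero = refl
  startsRun-runStart (suc i) with g i ≟ᴮ g (suc i)
  ... | yes _  = startsRun-runStart i
  ... | no neq = ≢⇒startsRun-suc i neq

  runEnd : ℕ → ℕ → ℕ
  runEnd i zero    = i
  runEnd i (suc d) = if ⌊ g i ≟ᴮ g (suc i) ⌋ then runEnd (suc i) d else i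

  runEnd-bounds : ∀ i d → i ≤ runEnd i d × runEnd i d ≤ i + d
  runEnd-bounds i zero = ≤-refl , m≤m+n i 0
  runEnd-bounds i (suc d) with g i ≟ᴮ g (suc i)
  ... | yes _ = ≤-trans (n≤1+n i) (proj₁ (runEnd-bounds (suc i) d)) ,
                subst (runEnd (suc i) d ≤_) (sym (+-suc i d)) (proj₂ (runEnd-bounds (suc i) d))
  ... | no _  = ≤-refl , m≤m+n i (suc d)

  runEnd-constant : ∀ i d j → i ≤ j → j ≤ runEnd i d → g j ≡ g i
  runEnd-constant i zero    j i≤j j≤e = cong g (≤-antisym j≤e i≤j)
  runEnd-constant i (suc d) j i≤j j≤e with g i ≟ᴮ g (suc i) | j ≟ i
  ... | _      | yes refl = refl
  ... | yes eq | no j≢    = trans (runEnd-constant (suc i) d j (≤∧≢⇒< i≤j (λ eq′ → j≢ (sym eq′))) j≤e) (sym eq)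
  ... | no _   | no j≢    = ⊥-elim (j≢ (≤-antisym j≤e i≤j))

  runEnd-maximal : ∀ i d → runEnd i d ≡ i + d ⊎ g (runEnd i d) ≢ g (suc (runEnd i d))
  runEnd-maximal i zero = inj₁ (sym (+-identityʳ i))
  runEnd-maximal i (suc d) with g i ≟ᴮ g (suc i)
  ... | no neq = inj₂ neq
  ... | yes _ with runEnd-maximal (suc i) d
  ...   | inj₁ eq  = inj₁ (trans eq (sym (+-suc i d)))
  ...   | inj₂ neq = inj₂ neq

  maxRunAt : ∀ x → x < n → Σ MaxRun λ X → first X ≤ x × x ≤ last X
  maxRunAt x x<n = X , runStart≤ x , proj₁ (runEnd-bounds x d)
    where
    d = n ∸ suc x
    x+d : suc (x + d) ≡ n
    x+d = m+[n∸m]≡n x<n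
    colour-x : ∀ j → runStart x ≤ j → j ≤ runEnd x d → g j ≡ g x
    colour-x j s≤j j≤e with ≤-total j x
    ... | inj₁ j≤x = runStart-constant x j s≤j j≤x
    ... | inj₂ x≤j = runEnd-constant x d j x≤j j≤e
    constant′ : ∀ j → runStart x ≤ j → j ≤ runEnd x d → g j ≡ g (runStart x)
    constant′ j s≤j j≤e = trans (colour-x j s≤j j≤e)
      (sym (colour-x (runStart x) ≤-refl (≤-trans (runStart≤ x) (proj₁ (runEnd-bounds x d)))))
    ends′ : suc (runEnd x d) ≡ n ⊎ g (runEnd x d) ≢ g (suc (runEnd x d))
    ends′ with runEnd-maximal x d
    ... | inj₁ eq  = inj₁ (trans (cong suc eq) x+d)
    ... | inj₂ neq = inj₂ neq
    X : MaxRun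
    X = record
      { first      = runStart x
      ; last       = runEnd x d
      ; first≤last = ≤-trans (runStart≤ x) (proj₁ (runEnd-bounds x d))
      ; last<n     = subst (suc (runEnd x d) ≤_) x+d (s≤s (proj₂ (runEnd-bounds x d)))
      ; constant   = constant′
      ; starts     = startsRun-runStart x
      ; ends       = ends′
      }

  no-start-inside : ∀ X {b} → first X < b → b ≤ last X → startsRun b ≢ true
  no-start-inside X {suc b} f<b b<l starts = startsRun-suc⇒≢ b starts
    (trans (constant X b (≤-pred f<b) (≤-trans (n≤1+n b) b<l))
           (sym (constant X (suc b) (<⇒≤ f<b) b<l)))

  startsRun⇒≤first : ∀ X {a} → startsRun a ≡ true → a ≤ last X → a ≤ first X
  startsRun⇒≤first X {a} starts a≤l with first X <? a
  ... | yes f<a = ⊥-elim (no-start-inside X f<a a≤l starts)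
  ... | no f≮a  = ≮⇒≥ f≮a

  startsRun⇒last< : ∀ X {b} → startsRun b ≡ true → first X < b → last X < b
  startsRun⇒last< X {b} starts f<b with last X <? b
  ... | yes l<b = l<b
  ... | no l≮b  = ⊥-elim (no-start-inside X f<b (≮⇒≥ l≮b) starts)

  last<first : ∀ X Y → colour X ≢ colour Y → first X ≤ first Y → last X < first Y
  last<first X Y colours≢ f≤f with last X <? first Y
  ... | yes l<f = l<f
  ... | no l≮f  = ⊥-elim (colours≢ (sym (constant X (first Y) f≤f (≮⇒≥ l≮f))))

  colour-before-first : ∀ X {p} → suc p ≡ first X → g p ≢ colour X
  colour-before-first X {p} eq g≡ = startsRun-suc⇒≢ p
    (subst (λ i → startsRun i ≡ true) (sym eq) (starts X)) (trans g≡ (cong g (sym eq)))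

  coloured⇒first≤ : ∀ X {s y x} → first X ≤ x → x ≤ last X → Coloured s y (suc x) → first X ≤ y
  coloured⇒first≤ X {s} {y} {x} f≤x x≤l coloured with y <? first X
  ... | no y≮f  = ≮⇒≥ y≮f
  ... | yes y<f = ⊥-elim (colour-before-first X suc-p (trans (coloured p y≤p p≤x) s≡colour))
    where
    p = first X ∸ 1
    suc-p : suc p ≡ first X
    suc-p = m+[n∸m]≡n (≤-trans (s≤s z≤n) y<f)
    y≤p : y ≤ p
    y≤p = ≤-pred (subst (suc y ≤_) (sym suc-p) y<f)
    p≤x : p < suc x
    p≤x = s≤s (≤-trans (m∸n≤m (first X) 1) f≤x)
    s≡colour : s ≡ colour X
    s≡colour = trans (sym (coloured x (≤-trans (<⇒≤ y<f) f≤x) ≤-refl)) (constant X x f≤x x≤l)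

  maxRunContaining : ∀ {s y z} → y < z → z ≤ n → Coloured s y z →
                     Σ MaxRun λ X → colour X ≡ s × first X ≤ y × z ≤ suc (last X)
  maxRunContaining {s} {y} {suc x} y≤x x<n coloured with maxRunAt x x<n
  ... | X , f≤x , x≤l = X , colour≡s , coloured⇒first≤ X f≤x x≤l coloured , s≤s x≤l
    where
    colour≡s : colour X ≡ s
    colour≡s = trans (sym (constant X x f≤x x≤l)) (coloured x (≤-pred y≤x) ≤-refl)

  ∸≤length : ∀ X {y z} → first X ≤ y → z ≤ suc (last X) → z ∸ y ≤ length X
  ∸≤length X f≤y z≤l = ≤-trans (∸-mono z≤l f≤y) (≤-reflexive (+-∸-assoc 1 (first≤last X)))

module Descent (n : ℕ) (g : ℕ → Bool) (q E : ℕ) .{{_ : NonZero n}} where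

  open Runs g
  open MaximalRuns n g

  gap : MaxRun → MaxRun → ℕ
  gap R B = first B ∸ suc (last R)

  runsBetween : MaxRun → MaxRun → ℕ
  runsBetween R B = sumRange startMark (suc (last R)) (first B)

  Separated : MaxRun → MaxRun → Set
  Separated R B = n * (1 + gap R B) ^ E ≤ (q * (length R ⊓ length B)) ^ E

  record Candidate : Set where
    field
      left right : MaxRun
      opposite   : colour left ≢ colour right
      ordered    : last left < first right
      few-runs   : runsBetween left right < q
      potential  : n ^ (1 + runsBetween left right) ≤ (q * (length left ⊓ length right)) ^ E

    gapC : ℕ
    gapC = gap left right

    minLength : ℕ
    minLength = length left ⊓ length right

  open Candidate public

  startsRun-after : ∀ R B → last R < first B → startsRun (suc (last R)) ≡ true
  startsRun-after R B l<f with ends R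
  ... | inj₁ eq  = ⊥-elim (<⇒≱ (first<n B) (subst (_≤ first B) eq l<f))
  ... | inj₂ neq = ≢⇒startsRun-suc (last R) neq

  gap-startsRun : ∀ C → startsRun (suc (last (left C))) ≡ true
  gap-startsRun C = startsRun-after (left C) (right C) (ordered C)

  gap-nonzero : ∀ C → ¬ Separated (left C) (right C) → 1 ≤ gapC C
  gap-nonzero C unseparated with gapC C | unseparated
  ... | zero  | unsep = ⊥-elim (unsep (≤-trans (n*1^E≤n^[1+r] n E (runsBetween (left C) (right C))) (potential C)))
  ... | suc _ | _     = s≤s z≤n

  longRunInGap : ∀ C → ¬ Separated (left C) (right C) →
    Σ MaxRun λ X → suc (last (left C)) ≤ first X × last X < first (right C) × 1 + gapC C ≤ q * length X
  longRunInGap C unseparated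
    with LongestRun.longestRun-anyColour g (suc (last (left C))) (gap-startsRun C) (gapC C)
  ... | _ , y , z , a≤y , z≤a+ℓ , coloured , ℓ≤rL = X , a≤first , last<b , long
    where
    a = suc (last (left C))
    b = first (right C)
    ℓ = gapC C
    r = runsBetween (left C) (right C)
    a+ℓ≡b : a + ℓ ≡ b
    a+ℓ≡b = m+[n∸m]≡n (ordered C)
    z≤b : z ≤ b
    z≤b = subst (z ≤_) a+ℓ≡b z≤a+ℓ
    L≢0 : z ∸ y ≢ 0
    L≢0 L≡0 = <⇒≱ (gap-nonzero C unseparated)
                  (≤-trans ℓ≤rL (≤-reflexive (trans (cong (r *_) L≡0) (*-zeroʳ r))))
    y<z : y < z
    y<z = m∸n≢0⇒n<m L≢0
    found = maxRunContaining y<z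
              (≤-trans z≤b (<⇒≤ (first<n (right C)))) coloured
    X = proj₁ found
    f≤y = proj₁ (proj₂ (proj₂ found))
    z≤l = proj₂ (proj₂ (proj₂ found))
    a≤first : a ≤ first X
    a≤first = startsRun⇒≤first X (gap-startsRun C)
                (≤-pred (≤-trans (≤-<-trans a≤y y<z) z≤l))
    last<b : last X < b
    last<b = startsRun⇒last< X (starts (right C)) (≤-<-trans f≤y (<-≤-trans y<z z≤b))
    long : 1 + ℓ ≤ q * length X
    long = begin
      1 + ℓ               ≤⟨ +-mono-≤ (n≢0⇒n>0 L≢0) ℓ≤rL ⟩
      (1 + r) * (z ∸ y)   ≤⟨ *-monoˡ-≤ (z ∸ y) (few-runs C) ⟩
      q * (z ∸ y)         ≤⟨ *-monoʳ-≤ q (∸≤length X f≤y z≤l) ⟩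
      q * length X        ∎
      where open ≤-Reasoning

  narrow : ∀ C → ¬ Separated (left C) (right C) → ∀ {L} → 1 + gapC C ≤ q * L →
           (R′ B′ : MaxRun) → colour R′ ≢ colour B′ → last R′ < first B′ →
           runsBetween R′ B′ < runsBetween (left C) (right C) →
           minLength C ⊓ L ≤ length R′ ⊓ length B′ → Candidate
  narrow C unseparated long R′ B′ opposite′ ordered′ fewer shorter = record
    { left      = R′
    ; right     = B′
    ; opposite  = opposite′
    ; ordered   = ordered′
    ; few-runs  = <-trans fewer (few-runs C)
    ; potential = potential-transfer n q E fewer (potential C) (≰⇒> unseparated) long shorter
    }

  improve : ∀ C → ¬ Separated (left C) (right C) → Σ Candidate λ C′ → gapC C′ < gapC C
  improve C unseparated = narrowTowards (colour X ≟ᴮ colour R)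
    where
    R = left C
    B = right C
    found = longRunInGap C unseparated
    X = proj₁ found
    a≤f : suc (last R) ≤ first X
    a≤f = proj₁ (proj₂ found)
    l<b : last X < first B
    l<b = proj₁ (proj₂ (proj₂ found))
    long : 1 + gapC C ≤ q * length X
    long = proj₂ (proj₂ (proj₂ found))
    narrowTowards : Dec (colour X ≡ colour R) → Σ Candidate λ C′ → gapC C′ < gapC C
    narrowTowards (no X≢R) =
      narrow C unseparated long R X (λ eq → X≢R (sym eq)) a≤f
             (sumRange-<-dropLast startMark (1≤𝟙 (starts X)) a≤f f<b)
             (⊓-monoˡ-≤ (length X) (m⊓n≤m (length R) (length B))) ,
      ∸-monoˡ-< f<b a≤f
      where
      f<b : first X < first B
      f<b = ≤-<-trans (first≤last X) l<b
    narrowTowards (yes X≡R) =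
      narrow C unseparated long X B (λ eq → opposite C (trans (sym X≡R) eq)) l<b
             (sumRange-<-dropFirst startMark (1≤𝟙 (gap-startsRun C)) a<l l<b)
             (≤-trans (⊓-monoˡ-≤ (length X) (m⊓n≤n (length R) (length B)))
                      (≤-reflexive (⊓-comm (length B) (length X)))) ,
      ∸-monoʳ-< a<l l<b
      where
      a<l : suc (last R) < suc (last X)
      a<l = s≤s (≤-trans a≤f (first≤last X))

  separate : ∀ fuel (C : Candidate) → gapC C ≤ fuel → Σ Candidate λ C′ → Separated (left C′) (right C′)
  separate fuel C gap≤ with n * (1 + gapC C) ^ E ≤? (q * minLength C) ^ E
  ... | yes separated = C , separated
  separate zero C gap≤ | no unseparated =
    ⊥-elim (<⇒≱ (gap-nonzero C unseparated) gap≤)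
  separate (suc fuel) C gap≤ | no unseparated with improve C unseparated
  ... | C′ , shorter = separate fuel C′ (≤-pred (≤-trans shorter gap≤))

  runsBetween+2≤ : ∀ R B → last R < first B → 2 + runsBetween R B ≤ startCount 0 n
  runsBetween+2≤ R B l<f = begin
    2 + runsBetween R B
      ≡⟨ cong suc (+-comm 1 (runsBetween R B)) ⟩
    1 + (runsBetween R B + 1)
      ≤⟨ +-mono-≤ (head≤sumRange h {0} {a} (s≤s z≤n)) (+-monoʳ-≤ (runsBetween R B) (≤-trans (1≤𝟙 (starts B)) (head≤sumRange h (first<n B)))) ⟩
    sumRange h 0 a + (sumRange h a (first B) + sumRange h (first B) n)
      ≡⟨ cong (sumRange h 0 a +_) (sym (sumRange-split h l<f (<⇒≤ (first<n B)))) ⟩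
    sumRange h 0 a + sumRange h a n
      ≡⟨ sym (sumRange-split h z≤n (≤-trans l<f (<⇒≤ (first<n B)))) ⟩
    sumRange h 0 n ∎
    where
    open ≤-Reasoning
    h = startMark
    a = suc (last R)

  initialCandidate : ∀ R B → colour R ≢ colour B → first R ≤ first B →
    n ≤ q * length R → n ≤ q * length B → 1 + runsBetween R B ≤ E → runsBetween R B < q → Candidate
  initialCandidate R B opposite′ f≤f longR longB exponent fewer = record
    { left      = R
    ; right     = B
    ; opposite  = opposite′
    ; ordered   = last<first R B opposite′ f≤f
    ; few-runs  = fewer
    ; potential = ≤-trans (^-monoʳ-≤ n {1 + runsBetween R B} {E} exponent) (^-monoˡ-≤ E n≤q*min)
    }
    where
    n≤q*min : n ≤ q * (length R ⊓ length B)
    n≤q*min = subst (n ≤_) (sym (*-distribˡ-⊓ q (length R) (length B))) (⊓-glb longR longB)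

sum-tabulate : ∀ {l} (F : Fin l → ℕ) h a → (∀ i → F i ≡ h (a + toℕ i)) → sum (tabulate F) ≡ sumFrom h a l
sum-tabulate {zero}  F h a F≡h = refl
sum-tabulate {suc l} F h a F≡h = cong₂ _+_
  (trans (F≡h fzero) (cong h (+-identityʳ a)))
  (sum-tabulate (λ i → F (fsuc i)) h (suc a) (λ i → trans (F≡h (fsuc i)) (cong h (+-suc a (toℕ i)))))

sum-allFin : ∀ {n} (F : Fin n → ℕ) h → (∀ i → F i ≡ h (toℕ i)) →
             sum (map F (allFin n)) ≡ sumFrom h 0 n
sum-allFin F h F≡h = trans (cong sum (map-tabulate (λ i → i) F)) (sum-tabulate F h 0 F≡h)

module _ (g : ℕ → Bool) where

  open Runs g

  startsBlock≡startsRun : ∀ {n} (f : Colouring n) → (∀ m → g (toℕ m) ≡ f m) →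
                          ∀ i → startsBlock f i ≡ startsRun (toℕ i)
  startsBlock≡startsRun {suc n} f g≡f fzero    = refl
  startsBlock≡startsRun {suc n} f g≡f (fsuc i) = cong not (cong₂ (λ u v → ⌊ u ≟ᴮ v ⌋)
    (trans (sym (g≡f (inject₁ i))) (cong g (toℕ-inject₁ i))) (sym (g≡f (fsuc i))))

  sideSize≡colourCount : ∀ {n} (f : Colouring n) → (∀ m → g (toℕ m) ≡ f m) →
                         ∀ s → sideSize f s ≡ colourCount s 0 n
  sideSize≡colourCount f g≡f s =
    sum-allFin _ _ (λ i → cong (λ b → 𝟙 ⌊ b ≟ᴮ s ⌋) (sym (g≡f i)))

  blockCount≡runCount : ∀ {n} (f : Colouring n) → (∀ m → g (toℕ m) ≡ f m) →
                        ∀ s → blockCount f s ≡ runCount s 0 n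
  blockCount≡runCount f g≡f s = sum-allFin _ _ (λ i → cong 𝟙 (cong₂ _∧_
    (cong (λ b → ⌊ b ≟ᴮ s ⌋) (sym (g≡f i))) (startsBlock≡startsRun f g≡f i)))

module FromColouring (n : ℕ) (f : Colouring n) where

  colourAt : ℕ → Bool
  colourAt j with j <? n
  ... | yes j<n = f (fromℕ< j<n)
  ... | no _    = false

  colourAt-toℕ : ∀ m → colourAt (toℕ m) ≡ f m
  colourAt-toℕ m with toℕ m <? n
  ... | yes m<n = cong f (fromℕ<-toℕ m m<n)
  ... | no m≮n  = ⊥-elim (m≮n (toℕ<n m))

  open Runs colourAt
  open MaximalRuns n colourAt

  module _ (X : MaxRun) where

    private
      toℕ-first : toℕ (fromℕ< (first<n X)) ≡ first X
      toℕ-first = toℕ-fromℕ< (first<n X)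

      toℕ-last : toℕ (fromℕ< (last<n X)) ≡ last X
      toℕ-last = toℕ-fromℕ< (last<n X)

      f-first : f (fromℕ< (first<n X)) ≡ colour X
      f-first = trans (sym (colourAt-toℕ _)) (cong colourAt toℕ-first)

    toBlock : Block f
    toBlock = record
      { start    = fromℕ< (first<n X)
      ; end      = fromℕ< (last<n X)
      ; ordered  = subst₂ _≤_ (sym toℕ-first) (sym toℕ-last) (first≤last X)
      ; constant = λ m f≤m m≤l → trans (sym (colourAt-toℕ m)) (trans
          (constant X (toℕ m) (subst (_≤ toℕ m) toℕ-first f≤m) (subst (toℕ m ≤_) toℕ-last m≤l))
          (sym f-first))
      ; maxLeft  = λ m suc-m≡ f≡ → colour-before-first X (trans suc-m≡ toℕ-first)
          (trans (colourAt-toℕ m) (trans f≡ f-first))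
      ; maxRight = maxRight′
      }
      where
      maxRight′ : ∀ m → toℕ m ≡ suc (toℕ (fromℕ< (last<n X))) → f m ≢ f (fromℕ< (first<n X))
      maxRight′ m m≡ f≡ with trans m≡ (cong suc toℕ-last) | ends X
      ... | m≡suc-last | inj₁ suc-last≡n = <⇒≢ (toℕ<n m) (trans m≡suc-last suc-last≡n)
      ... | m≡suc-last | inj₂ change     = change (begin
        colourAt (last X)       ≡⟨ constant X (last X) (first≤last X) ≤-refl ⟩
        colour X                ≡⟨ sym f-first ⟩
        f (fromℕ< (first<n X))  ≡⟨ sym f≡ ⟩
        f m                     ≡⟨ sym (colourAt-toℕ m) ⟩
        colourAt (toℕ m)        ≡⟨ cong colourAt m≡suc-last ⟩
        colourAt (suc (last X)) ∎)
        where open ≡-Reasoning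

    side-toBlock : side toBlock ≡ colour X
    side-toBlock = f-first

    size-toBlock : size toBlock ≡ length X
    size-toBlock = cong suc (cong₂ _∸_ toℕ-last toℕ-first)

  between-toBlock : ∀ R B → last R < first B → between (toBlock R) (toBlock B) ≡ first B ∸ suc (last R)
  between-toBlock R B l<f
    rewrite toℕ-fromℕ< (last<n R) | toℕ-fromℕ< (first<n B)
    with last R <ᵇ first B in eq
  ... | true  = refl
  ... | false = ⊥-elim (subst T eq (<⇒<ᵇ l<f))

module BalancedColouring (c n : ℕ) .{{_ : NonZero n}} (f : Colouring n)
                         (balanced : Balanced f) (few : ∀ s → blockCount f s ≤ c) where

  q : ℕ
  q = 3 * c + 1

  open FromColouring n f
  open Runs colourAt
  open MaximalRuns n colourAt
  open Descent n colourAt q (c * c)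

  bigRun : ∀ s → Σ MaxRun λ X → colour X ≡ s × n ≤ q * length X
  bigRun s = X , colour≡s , ≤-trans n≤qL (*-monoʳ-≤ q (∸≤length X first≤y z≤last))
    where
    found = LongestRun.OfColour.longestRun colourAt 0 refl s n
    y = proj₁ found
    z = proj₁ (proj₂ found)
    z≤n₀ : z ≤ n
    z≤n₀ = proj₁ (proj₂ (proj₂ (proj₂ found)))
    coloured : Coloured s y z
    coloured = proj₁ (proj₂ (proj₂ (proj₂ (proj₂ found))))
    count≤ : colourCount s 0 n ≤ runCount s 0 n * (z ∸ y)
    count≤ = proj₂ (proj₂ (proj₂ (proj₂ (proj₂ found))))
    n≤qL : n ≤ q * (z ∸ y)
    n≤qL = begin
      n                               ≤⟨ balanced s ⟩
      3 * sideSize f s                ≡⟨ cong (3 *_) (sideSize≡colourCount colourAt f colourAt-toℕ s) ⟩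
      3 * colourCount s 0 n           ≤⟨ *-monoʳ-≤ 3 count≤ ⟩
      3 * (runCount s 0 n * (z ∸ y))  ≤⟨ *-monoʳ-≤ 3 (*-monoˡ-≤ (z ∸ y) runs≤c) ⟩
      3 * (c * (z ∸ y))               ≡⟨ sym (*-assoc 3 c (z ∸ y)) ⟩
      3 * c * (z ∸ y)                 ≤⟨ *-monoˡ-≤ (z ∸ y) (m≤m+n (3 * c) 1) ⟩
      q * (z ∸ y)                     ∎
      where
      open ≤-Reasoning
      runs≤c = subst (_≤ c) (blockCount≡runCount colourAt f colourAt-toℕ s) (few s)
    y<z : y < z
    y<z = m∸n≢0⇒n<m λ L≡0 →
      <⇒≱ (>-nonZero⁻¹ n) (subst (n ≤_) (trans (cong (q *_) L≡0) (*-zeroʳ q)) n≤qL)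
    contained = maxRunContaining y<z z≤n₀ coloured
    X = proj₁ contained
    colour≡s = proj₁ (proj₂ contained)
    first≤y = proj₁ (proj₂ (proj₂ contained))
    z≤last = proj₂ (proj₂ (proj₂ contained))

  candidateFrom : ∀ R B → colour R ≢ colour B → first R ≤ first B →
                  n ≤ q * length R → n ≤ q * length B → Candidate
  candidateFrom R B opposite′ f≤f longR longB =
    initialCandidate R B opposite′ f≤f longR longB (2+r≤c+c⇒1+r≤c*c c r bound) (2+r≤c+c⇒r<3c+1 c r bound)
    where
    r = runsBetween R B
    allRuns≡ : blockCount f true + blockCount f false ≡ startCount 0 n
    allRuns≡ = trans (cong₂ _+_ (blockCount≡runCount colourAt f colourAt-toℕ true)
                                (blockCount≡runCount colourAt f colourAt-toℕ false))
                     (runCount-partition 0 n)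
    bound : 2 + r ≤ c + c
    bound = ≤-trans (runsBetween+2≤ R B (last<first R B opposite′ f≤f))
                    (subst (_≤ c + c) allRuns≡ (+-mono-≤ (few true) (few false)))

  initial : Candidate
  initial = orient (≤-total (first Xᵗ) (first Xᶠ))
    where
    Xᵗ = proj₁ (bigRun true)
    Xᶠ = proj₁ (bigRun false)
    Xᵗ-long = proj₂ (proj₂ (bigRun true))
    Xᶠ-long = proj₂ (proj₂ (bigRun false))
    Xᵗ≢Xᶠ : colour Xᵗ ≢ colour Xᶠ
    Xᵗ≢Xᶠ eq with trans (sym (proj₁ (proj₂ (bigRun true)))) (trans eq (proj₁ (proj₂ (bigRun false))))
    ... | ()
    orient : first Xᵗ ≤ first Xᶠ ⊎ first Xᶠ ≤ first Xᵗ → Candidate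
    orient (inj₁ Xᵗ≤Xᶠ) = candidateFrom Xᵗ Xᶠ Xᵗ≢Xᶠ Xᵗ≤Xᶠ Xᵗ-long Xᶠ-long
    orient (inj₂ Xᶠ≤Xᵗ) = candidateFrom Xᶠ Xᵗ (λ eq → Xᵗ≢Xᶠ (sym eq)) Xᶠ≤Xᵗ Xᶠ-long Xᵗ-long

  separatedBlocks : Σ (Block f) λ R → Σ (Block f) λ B → side R ≢ side B ×
    n * (1 + between R B) ^ (c * c) ≤ (q * (size R ⊓ size B)) ^ (c * c)
  separatedBlocks =
    toBlock R , toBlock B ,
    (λ eq → opposite C (trans (sym (side-toBlock R)) (trans eq (side-toBlock B)))) ,
    subst₂ (λ u v → n * (1 + u) ^ (c * c) ≤ (q * v) ^ (c * c))
           (sym (between-toBlock R B (ordered C)))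
           (sym (cong₂ _⊓_ (size-toBlock R) (size-toBlock B)))
           (proj₂ found)
    where
    gap≤n : gapC initial ≤ n
    gap≤n = ≤-trans (m∸n≤m (first (right initial)) (suc (last (left initial))))
                    (<⇒≤ (first<n (right initial)))
    found = separate n initial gap≤n
    C = proj₁ found
    R = left C
    B = right C

lemma14 : ∀ (c : ℕ) → 1 ≤ c →
    Σ ℕ λ q → 1 ≤ q × Σ ℕ λ k₀ →
    ∀ (k : ℕ) → k₀ < k →
    ∀ (f : Colouring (3 ^ k)) → Balanced f →
    (∀ (s : Bool) → blockCount f s ≤ c) →
    Σ (Block f) λ R → Σ (Block f) λ B →
    (side R ≢ side B) ×
    (3 ^ k * (1 + between R B) ^ (c * c) ≤ (q * (size R ⊓ size B)) ^ (c * c))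
lemma14 c _ = 3 * c + 1 , m≤n+m 1 (3 * c) , 0 , λ k _ f balanced few →
  BalancedColouring.separatedBlocks c (3 ^ k) {{m^n≢0 3 k}} f balanced few
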